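{- Let \(G\) be a graph with \(\Delta(G)\leq 4\). Let \(x,y_{1},y_{2},z_{1},z_{2}\) be vertices of \(G\) such that \(q=\{x,y_{1},z_{1}\}\), \(q_{1}=\{x,y_{1},y_{2}\}\) and \(q_{2}=\{x,z_{1},z_{2}\}\) are cliques of \(G\). Let \(q'\) be a clique of \(G\) with \(x\in q'\) and \(q'\notin\{q,q_{1},q_{2}\}\). Then \(q'=\{x,y_{2},z_{2}\}\), and in particular \(y_{2}\sim z_{2}\).
   Context: All graphs are finite and simple; a clique is a maximal complete subgraph; \(\sim\) denotes adjacency; \(\Delta(G)\) is the maximum degree. -}

module Defs where

open import Data.Nat using (ℕ; _≤_)
open import Data.Product using (_×_)
open import Data.Bool using (Bool; true; false)
open import Data.Fin using (Fin)
open import Data.Fin.Subset using (Subset; _∈_; _⊆_; ∣_∣)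
open import Data.Vec using (tabulate)
open import Relation.Binary.PropositionalEquality using (_≡_)
open import Relation.Nullary using (¬_)

record Graph (n : ℕ) : Set where
  field
    adj     : Fin n → Fin n → Bool
    sym     : ∀ u v → adj u v ≡ adj v u
    irrefl  : ∀ v → adj v v ≡ false

open Graph public

_∼[_]_ : {n : ℕ} → Fin n → Graph n → Fin n → Set
u ∼[ G ] v = adj G u v ≡ true

nbhd : {n : ℕ} → Graph n → Fin n → Subset n
nbhd G v = tabulate (adj G v)

degree : {n : ℕ} → Graph n → Fin n → ℕ
degree G v = ∣ nbhd G v ∣

MaxDegreeAtMost : {n : ℕ} → Graph n → ℕ → Set
MaxDegreeAtMost G d = ∀ v → degree G v ≤ d

IsComplete : {n : ℕ} → Graph n → Subset n → Set
IsComplete G S = ∀ u v → u ∈ S → v ∈ S → ¬ (u ≡ v) → u ∼[ G ] v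

IsClique : {n : ℕ} → Graph n → Subset n → Set
IsClique G S = IsComplete G S × (∀ T → IsComplete G T → S ⊆ T → T ⊆ S)

-- Since Δ(G) ≤ 4 and y₁, y₂, z₁, z₂ are four distinct neighbours of x, they are
-- all of its neighbours, so every clique through x is {x} together with some of
-- y₁, y₂, z₁, z₂. Maximality of q = {x, y₁, z₁} forbids the edges y₁z₂ and y₂z₁
-- (either would extend q), so a clique q′ through x contains at most one vertex
-- of each of {y₁, z₂} and {y₂, z₁}. If q′ missed both vertices of {y₂, z₂},
-- {z₁, z₂} or {y₁, y₂} it would lie inside, hence equal, q, q₁ or q₂; the only
-- way to meet all three pairs under the two constraints is to contain y₂ and z₂
-- but neither y₁ nor z₁, so q′ = {x, y₂, z₂}.
module Submission where

open import Defs
open import Data.Nat using (ℕ; _≤_; z≤n)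
open import Data.Nat.Properties using (≤-<-trans; <⇒≱)
open import Data.Fin using (Fin; _≟_)
open import Data.Fin.Subset using (Subset; _∈_; _∉_; _∪_; ⁅_⁆; _⊆_; _-_; ∣_∣)
open import Data.Fin.Subset.Properties
  using (x∈⁅x⁆; x∈⁅y⁆⇒x≡y; x∈p∪q⁻; x∈p∪q⁺; ⊆-antisym;
         x∈p∧x≢y⇒x∈p-y; x∈p⇒∣p-x∣<∣p∣; _∈?_)
open import Data.List using (List; []; _∷_; length)
open import Data.List.Membership.Propositional using () renaming (_∈_ to _∈ₗ_)
import Data.List.Membership.DecPropositional as DecMembership
open import Data.List.Relation.Unary.All as All using (All; []; _∷_)
open import Data.List.Relation.Unary.All.Properties using (¬Any⇒All¬)
open import Data.List.Relation.Unary.Any using (here; there)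
open import Data.List.Relation.Unary.Unique.Propositional using (Unique; []; _∷_)
open import Data.Vec.Properties using (lookup⇒[]=; lookup∘tabulate)
open import Data.Product using (_×_; _,_; proj₁; proj₂)
open import Data.Sum using (_⊎_; inj₁; inj₂; [_,_])
open import Function using (_∘_)
open import Relation.Nullary using (¬_; yes; no; contradiction)
open import Relation.Binary.PropositionalEquality
  using (_≡_; _≢_; refl; trans; ≢-sym) renaming (sym to ≡-sym)

module _ {n : ℕ} where

  Unique∧All∈⇒length≤∣p∣ : {xs : List (Fin n)} {p : Subset n} →
                           Unique xs → All (_∈ p) xs → length xs ≤ ∣ p ∣
  Unique∧All∈⇒length≤∣p∣ [] [] = z≤n
  Unique∧All∈⇒length≤∣p∣ {x ∷ xs} {p} (x≢xs ∷ xs!) (x∈p ∷ xs⊆p) =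
    ≤-<-trans (Unique∧All∈⇒length≤∣p∣ xs! xs⊆p-x) (x∈p⇒∣p-x∣<∣p∣ x∈p)
    where
      xs⊆p-x : All (_∈ p - x) xs
      xs⊆p-x = All.zipWith (λ (x≢y , y∈p) → x∈p∧x≢y⇒x∈p-y y∈p (≢-sym x≢y)) (x≢xs , xs⊆p)

  triangle : Fin n → Fin n → Fin n → Subset n
  triangle a b c = ⁅ a ⁆ ∪ ⁅ b ⁆ ∪ ⁅ c ⁆

  ∈-triangle⁺ : {w a b c : Fin n} → w ≡ a ⊎ w ≡ b ⊎ w ≡ c → w ∈ triangle a b c
  ∈-triangle⁺ (inj₁ refl)        = x∈p∪q⁺ (inj₁ (x∈⁅x⁆ _))
  ∈-triangle⁺ (inj₂ (inj₁ refl)) = x∈p∪q⁺ (inj₂ (x∈p∪q⁺ (inj₁ (x∈⁅x⁆ _))))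
  ∈-triangle⁺ (inj₂ (inj₂ refl)) = x∈p∪q⁺ (inj₂ (x∈p∪q⁺ (inj₂ (x∈⁅x⁆ _))))

  ∈-triangle⁻ : {w a b c : Fin n} → w ∈ triangle a b c → w ≡ a ⊎ w ≡ b ⊎ w ≡ c
  ∈-triangle⁻ {a = a} {b} {c} w∈ with x∈p∪q⁻ ⁅ a ⁆ _ w∈
  ... | inj₁ w∈a  = inj₁ (x∈⁅y⁆⇒x≡y a w∈a)
  ... | inj₂ w∈bc with x∈p∪q⁻ ⁅ b ⁆ ⁅ c ⁆ w∈bc
  ...   | inj₁ w∈b = inj₂ (inj₁ (x∈⁅y⁆⇒x≡y b w∈b))
  ...   | inj₂ w∈c = inj₂ (inj₂ (x∈⁅y⁆⇒x≡y c w∈c))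

  ∉-triangle : {w a b c : Fin n} → w ≢ a → w ≢ b → w ≢ c → w ∉ triangle a b c
  ∉-triangle w≢a w≢b w≢c = [ w≢a , [ w≢b , w≢c ] ] ∘ ∈-triangle⁻

module _ {n : ℕ} (G : Graph n) where

  open DecMembership (_≟_ {n}) using () renaming (_∈?_ to _∈ₗ?_)

  ∼-sym : {u v : Fin n} → u ∼[ G ] v → v ∼[ G ] u
  ∼-sym {u} {v} u∼v = trans (Graph.sym G v u) u∼v

  ∼⇒∈nbhd : {u v : Fin n} → u ∼[ G ] v → v ∈ nbhd G u
  ∼⇒∈nbhd {u} {v} u∼v = lookup⇒[]= v (nbhd G u) (trans (lookup∘tabulate (adj G u) v) u∼v)

  ∼⇒∈saturating-list : {v w : Fin n} {xs : List (Fin n)} →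
                       MaxDegreeAtMost G (length xs) → Unique xs → All (v ∼[ G ]_) xs →
                       v ∼[ G ] w → w ∈ₗ xs
  ∼⇒∈saturating-list {v} {w} {xs} Δ≤ xs! v∼xs v∼w with w ∈ₗ? xs
  ... | yes w∈xs = w∈xs
  ... | no  w∉xs = contradiction (Δ≤ v) (<⇒≱ w∷xs≤degree)
    where
      w∷xs≤degree : length (w ∷ xs) ≤ degree G v
      w∷xs≤degree = Unique∧All∈⇒length≤∣p∣ (¬Any⇒All¬ xs w∉xs ∷ xs!)
                                           (All.map ∼⇒∈nbhd (v∼w ∷ v∼xs))

  CompleteTo : Fin n → Subset n → Set
  CompleteTo v S = ∀ u → u ∈ S → v ≢ u → v ∼[ G ] u

  completeTo-⁅⁆ : {v a : Fin n} → v ∼[ G ] a → CompleteTo v ⁅ a ⁆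
  completeTo-⁅⁆ v∼a u u∈a _ rewrite x∈⁅y⁆⇒x≡y _ u∈a = v∼a

  completeTo-∪ : {v a : Fin n} {S : Subset n} →
                 v ∼[ G ] a → CompleteTo v S → CompleteTo v (⁅ a ⁆ ∪ S)
  completeTo-∪ {a = a} {S} v∼a v∼S u u∈aS v≢u =
    [ (λ u∈a → completeTo-⁅⁆ v∼a u u∈a v≢u) , (λ u∈S → v∼S u u∈S v≢u) ] (x∈p∪q⁻ ⁅ a ⁆ S u∈aS)

  completeTo-triangle : {v a b c : Fin n} →
                        v ∼[ G ] a → v ∼[ G ] b → v ∼[ G ] c → CompleteTo v (triangle a b c)
  completeTo-triangle v∼a v∼b v∼c = completeTo-∪ v∼a (completeTo-∪ v∼b (completeTo-⁅⁆ v∼c))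

  ⁅⁆-complete : {a : Fin n} → IsComplete G ⁅ a ⁆
  ⁅⁆-complete {a} u v u∈a v∈a u≢v =
    contradiction (trans (x∈⁅y⁆⇒x≡y a u∈a) (≡-sym (x∈⁅y⁆⇒x≡y a v∈a))) u≢v

  ∪-complete : {v : Fin n} {S : Subset n} →
               IsComplete G S → CompleteTo v S → IsComplete G (⁅ v ⁆ ∪ S)
  ∪-complete {v} {S} S-complete v∼S u w u∈ w∈ u≢w with x∈p∪q⁻ ⁅ v ⁆ S u∈ | x∈p∪q⁻ ⁅ v ⁆ S w∈
  ... | inj₁ u∈v | inj₁ w∈v = ⁅⁆-complete u w u∈v w∈v u≢w
  ... | inj₁ u∈v | inj₂ w∈S rewrite x∈⁅y⁆⇒x≡y v u∈v = v∼S w w∈S u≢w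
  ... | inj₂ u∈S | inj₁ w∈v rewrite x∈⁅y⁆⇒x≡y v w∈v = ∼-sym (v∼S u u∈S (≢-sym u≢w))
  ... | inj₂ u∈S | inj₂ w∈S = S-complete u w u∈S w∈S u≢w

  triangle-complete : {a b c : Fin n} →
                      a ∼[ G ] b → a ∼[ G ] c → b ∼[ G ] c → IsComplete G (triangle a b c)
  triangle-complete a∼b a∼c b∼c =
    ∪-complete (∪-complete ⁅⁆-complete (completeTo-⁅⁆ b∼c)) (completeTo-∪ a∼b (completeTo-⁅⁆ a∼c))

  triangle-edges : {a b c : Fin n} → IsComplete G (triangle a b c) →
                   a ≢ b → a ≢ c → b ≢ c → a ∼[ G ] b × a ∼[ G ] c × b ∼[ G ] c
  triangle-edges complete a≢b a≢c b≢c =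
      complete _ _ (∈-triangle⁺ (inj₁ refl)) (∈-triangle⁺ (inj₂ (inj₁ refl))) a≢b
    , complete _ _ (∈-triangle⁺ (inj₁ refl)) (∈-triangle⁺ (inj₂ (inj₂ refl))) a≢c
    , complete _ _ (∈-triangle⁺ (inj₂ (inj₁ refl))) (∈-triangle⁺ (inj₂ (inj₂ refl))) b≢c

  clique⊆complete⇒≡ : {S T : Subset n} → IsClique G S → IsComplete G T → S ⊆ T → S ≡ T
  clique⊆complete⇒≡ (_ , maximal) T-complete S⊆T = ⊆-antisym S⊆T (maximal _ T-complete S⊆T)

  clique-absorbs : {v : Fin n} {S : Subset n} → IsClique G S → CompleteTo v S → v ∈ S
  clique-absorbs {v} {S} S-clique v∼S =
    proj₂ S-clique _ (∪-complete (proj₁ S-clique) v∼S) (x∈p∪q⁺ ∘ inj₂) (x∈p∪q⁺ (inj₁ (x∈⁅x⁆ v)))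

module ThreeCliquesAt {n : ℕ} (G : Graph n) (Δ≤4 : MaxDegreeAtMost G 4) {x y₁ y₂ z₁ z₂ : Fin n}
  (x≢y₁ : x ≢ y₁) (x≢y₂ : x ≢ y₂) (x≢z₁ : x ≢ z₁) (x≢z₂ : x ≢ z₂)
  (y₁≢y₂ : y₁ ≢ y₂) (y₁≢z₁ : y₁ ≢ z₁) (y₁≢z₂ : y₁ ≢ z₂)
  (y₂≢z₁ : y₂ ≢ z₁) (y₂≢z₂ : y₂ ≢ z₂) (z₁≢z₂ : z₁ ≢ z₂)
  (q-clique : IsClique G (triangle x y₁ z₁))
  (q₁-clique : IsClique G (triangle x y₁ y₂))
  (q₂-clique : IsClique G (triangle x z₁ z₂)) where

  x∼y₁ : x ∼[ G ] y₁
  x∼y₁ = proj₁ (triangle-edges G (proj₁ q-clique) x≢y₁ x≢z₁ y₁≢z₁)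

  x∼z₁ : x ∼[ G ] z₁
  x∼z₁ = proj₁ (proj₂ (triangle-edges G (proj₁ q-clique) x≢y₁ x≢z₁ y₁≢z₁))

  x∼y₂ : x ∼[ G ] y₂
  x∼y₂ = proj₁ (proj₂ (triangle-edges G (proj₁ q₁-clique) x≢y₁ x≢y₂ y₁≢y₂))

  y₁∼y₂ : y₁ ∼[ G ] y₂
  y₁∼y₂ = proj₂ (proj₂ (triangle-edges G (proj₁ q₁-clique) x≢y₁ x≢y₂ y₁≢y₂))

  x∼z₂ : x ∼[ G ] z₂
  x∼z₂ = proj₁ (proj₂ (triangle-edges G (proj₁ q₂-clique) x≢z₁ x≢z₂ z₁≢z₂))

  z₁∼z₂ : z₁ ∼[ G ] z₂
  z₁∼z₂ = proj₂ (proj₂ (triangle-edges G (proj₁ q₂-clique) x≢z₁ x≢z₂ z₁≢z₂))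

  neighbours : List (Fin n)
  neighbours = y₁ ∷ y₂ ∷ z₁ ∷ z₂ ∷ []

  neighbours-unique : Unique neighbours
  neighbours-unique =
    (y₁≢y₂ ∷ y₁≢z₁ ∷ y₁≢z₂ ∷ []) ∷ (y₂≢z₁ ∷ y₂≢z₂ ∷ []) ∷ (z₁≢z₂ ∷ []) ∷ [] ∷ []

  x∼⇒∈neighbours : {w : Fin n} → x ∼[ G ] w → w ∈ₗ neighbours
  x∼⇒∈neighbours = ∼⇒∈saturating-list G Δ≤4 neighbours-unique (x∼y₁ ∷ x∼y₂ ∷ x∼z₁ ∷ x∼z₂ ∷ [])

  y₁≁z₂ : ¬ (y₁ ∼[ G ] z₂)
  y₁≁z₂ y₁∼z₂ = ∉-triangle (≢-sym x≢z₂) (≢-sym y₁≢z₂) (≢-sym z₁≢z₂)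
    (clique-absorbs G q-clique (completeTo-triangle G (∼-sym G x∼z₂) (∼-sym G y₁∼z₂) (∼-sym G z₁∼z₂)))

  y₂≁z₁ : ¬ (y₂ ∼[ G ] z₁)
  y₂≁z₁ y₂∼z₁ = ∉-triangle (≢-sym x≢y₂) (≢-sym y₁≢y₂) y₂≢z₁
    (clique-absorbs G q-clique (completeTo-triangle G (∼-sym G x∼y₂) (∼-sym G y₁∼y₂) y₂∼z₁))

  module _ {q′ : Subset n} (q′-clique : IsClique G q′) (x∈q′ : x ∈ q′) where

    ∈q′⇒≡x⊎∈neighbours : {w : Fin n} → w ∈ q′ → w ≡ x ⊎ w ∈ₗ neighbours
    ∈q′⇒≡x⊎∈neighbours {w} w∈q′ with w ≟ x
    ... | yes w≡x = inj₁ w≡x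
    ... | no  w≢x = inj₂ (x∼⇒∈neighbours (proj₁ q′-clique x w x∈q′ w∈q′ (≢-sym w≢x)))

    ≡triangle : {a b : Fin n} → IsComplete G (triangle x a b) →
                (∀ {w} → w ∈ q′ → w ∈ₗ neighbours → w ≡ a ⊎ w ≡ b) → q′ ≡ triangle x a b
    ≡triangle xab-complete classify = clique⊆complete⇒≡ G q′-clique xab-complete q′⊆xab
      where
        q′⊆xab : q′ ⊆ triangle x _ _
        q′⊆xab w∈q′ = ∈-triangle⁺ ([ inj₁ , inj₂ ∘ classify w∈q′ ] (∈q′⇒≡x⊎∈neighbours w∈q′))

    y₁∈⇒z₂∉ : y₁ ∈ q′ → z₂ ∉ q′
    y₁∈⇒z₂∉ y₁∈ z₂∈ = y₁≁z₂ (proj₁ q′-clique y₁ z₂ y₁∈ z₂∈ y₁≢z₂)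

    z₁∈⇒y₂∉ : z₁ ∈ q′ → y₂ ∉ q′
    z₁∈⇒y₂∉ z₁∈ y₂∈ = y₂≁z₁ (proj₁ q′-clique y₂ z₁ y₂∈ z₁∈ y₂≢z₁)

    ≡q : y₂ ∉ q′ → z₂ ∉ q′ → q′ ≡ triangle x y₁ z₁
    ≡q y₂∉ z₂∉ = ≡triangle (proj₁ q-clique) classify
      where
        classify : ∀ {w} → w ∈ q′ → w ∈ₗ neighbours → w ≡ y₁ ⊎ w ≡ z₁
        classify _   (here w≡y₁)                         = inj₁ w≡y₁
        classify y₂∈ (there (here refl))                 = contradiction y₂∈ y₂∉
        classify _   (there (there (here w≡z₁)))         = inj₂ w≡z₁
        classify z₂∈ (there (there (there (here refl)))) = contradiction z₂∈ z₂∉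

    ≡q₁ : z₁ ∉ q′ → z₂ ∉ q′ → q′ ≡ triangle x y₁ y₂
    ≡q₁ z₁∉ z₂∉ = ≡triangle (proj₁ q₁-clique) classify
      where
        classify : ∀ {w} → w ∈ q′ → w ∈ₗ neighbours → w ≡ y₁ ⊎ w ≡ y₂
        classify _   (here w≡y₁)                         = inj₁ w≡y₁
        classify _   (there (here w≡y₂))                 = inj₂ w≡y₂
        classify z₁∈ (there (there (here refl)))         = contradiction z₁∈ z₁∉
        classify z₂∈ (there (there (there (here refl)))) = contradiction z₂∈ z₂∉

    ≡q₂ : y₁ ∉ q′ → y₂ ∉ q′ → q′ ≡ triangle x z₁ z₂
    ≡q₂ y₁∉ y₂∉ = ≡triangle (proj₁ q₂-clique) classify
      where
        classify : ∀ {w} → w ∈ q′ → w ∈ₗ neighbours → w ≡ z₁ ⊎ w ≡ z₂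
        classify y₁∈ (here refl)                         = contradiction y₁∈ y₁∉
        classify y₂∈ (there (here refl))                 = contradiction y₂∈ y₂∉
        classify _   (there (there (here w≡z₁)))         = inj₁ w≡z₁
        classify _   (there (there (there (here w≡z₂)))) = inj₂ w≡z₂

    ≡xy₂z₂ : y₁ ∉ q′ → z₁ ∉ q′ → y₂ ∼[ G ] z₂ → q′ ≡ triangle x y₂ z₂
    ≡xy₂z₂ y₁∉ z₁∉ y₂∼z₂ = ≡triangle (triangle-complete G x∼y₂ x∼z₂ y₂∼z₂) classify
      where
        classify : ∀ {w} → w ∈ q′ → w ∈ₗ neighbours → w ≡ y₂ ⊎ w ≡ z₂
        classify y₁∈ (here refl)                         = contradiction y₁∈ y₁∉
        classify _   (there (here w≡y₂))                 = inj₁ w≡y₂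
        classify z₁∈ (there (there (here refl)))         = contradiction z₁∈ z₁∉
        classify _   (there (there (there (here w≡z₂)))) = inj₂ w≡z₂

    cliques-through-x : q′ ≡ triangle x y₁ z₁ ⊎ q′ ≡ triangle x y₁ y₂ ⊎ q′ ≡ triangle x z₁ z₂ ⊎
                        (q′ ≡ triangle x y₂ z₂ × y₂ ∼[ G ] z₂)
    cliques-through-x with y₁ ∈? q′ | z₁ ∈? q′ | y₂ ∈? q′ | z₂ ∈? q′
    ... | yes y₁∈ | yes z₁∈ | _       | _       = inj₁ (≡q (z₁∈⇒y₂∉ z₁∈) (y₁∈⇒z₂∉ y₁∈))
    ... | yes y₁∈ | no  z₁∉ | _       | _       = inj₂ (inj₁ (≡q₁ z₁∉ (y₁∈⇒z₂∉ y₁∈)))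
    ... | no  y₁∉ | yes z₁∈ | _       | _       = inj₂ (inj₂ (inj₁ (≡q₂ y₁∉ (z₁∈⇒y₂∉ z₁∈))))
    ... | no  y₁∉ | no  _   | no  y₂∉ | _       = inj₂ (inj₂ (inj₁ (≡q₂ y₁∉ y₂∉)))
    ... | no  _   | no  z₁∉ | yes _   | no  z₂∉ = inj₂ (inj₁ (≡q₁ z₁∉ z₂∉))
    ... | no  y₁∉ | no  z₁∉ | yes y₂∈ | yes z₂∈ = inj₂ (inj₂ (inj₂ (≡xy₂z₂ y₁∉ z₁∉ y₂∼z₂ , y₂∼z₂)))
      where
        y₂∼z₂ : y₂ ∼[ G ] z₂
        y₂∼z₂ = proj₁ q′-clique y₂ z₂ y₂∈ z₂∈ y₂≢z₂

mainTheorem7 : {n : ℕ} (G : Graph n) → MaxDegreeAtMost G 4 →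
    (x y₁ y₂ z₁ z₂ : Fin n) →
    x ≢ y₁ → x ≢ y₂ → x ≢ z₁ → x ≢ z₂ → y₁ ≢ y₂ → y₁ ≢ z₁ → y₁ ≢ z₂ →
    y₂ ≢ z₁ → y₂ ≢ z₂ → z₁ ≢ z₂ →
    IsClique G (⁅ x ⁆ ∪ ⁅ y₁ ⁆ ∪ ⁅ z₁ ⁆) →
    IsClique G (⁅ x ⁆ ∪ ⁅ y₁ ⁆ ∪ ⁅ y₂ ⁆) →
    IsClique G (⁅ x ⁆ ∪ ⁅ z₁ ⁆ ∪ ⁅ z₂ ⁆) →
    (q′ : Subset n) → IsClique G q′ → x ∈ q′ →
    q′ ≢ (⁅ x ⁆ ∪ ⁅ y₁ ⁆ ∪ ⁅ z₁ ⁆) →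
    q′ ≢ (⁅ x ⁆ ∪ ⁅ y₁ ⁆ ∪ ⁅ y₂ ⁆) →
    q′ ≢ (⁅ x ⁆ ∪ ⁅ z₁ ⁆ ∪ ⁅ z₂ ⁆) →
    (q′ ≡ (⁅ x ⁆ ∪ ⁅ y₂ ⁆ ∪ ⁅ z₂ ⁆)) × (y₂ ∼[ G ] z₂)
mainTheorem7 G Δ≤4 x y₁ y₂ z₁ z₂ x≢y₁ x≢y₂ x≢z₁ x≢z₂ y₁≢y₂ y₁≢z₁ y₁≢z₂ y₂≢z₁ y₂≢z₂ z₁≢z₂
             q-clique q₁-clique q₂-clique q′ q′-clique x∈q′ q′≢q q′≢q₁ q′≢q₂
  with ThreeCliquesAt.cliques-through-x G Δ≤4 x≢y₁ x≢y₂ x≢z₁ x≢z₂ y₁≢y₂ y₁≢z₁ y₁≢z₂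
         y₂≢z₁ y₂≢z₂ z₁≢z₂ q-clique q₁-clique q₂-clique q′-clique x∈q′
... | inj₁ q′≡q                 = contradiction q′≡q q′≢q
... | inj₂ (inj₁ q′≡q₁)         = contradiction q′≡q₁ q′≢q₁
... | inj₂ (inj₂ (inj₁ q′≡q₂))  = contradiction q′≡q₂ q′≢q₂
... | inj₂ (inj₂ (inj₂ result)) = result
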